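{- Let $q$ be a prime power, $n\ge 2$ an integer, $m$ a positive integer not exceeding the characteristic of $\mathbb{F}_{q^n}$, $\beta\in\mathbb{F}_{q^n}^*$, and $k$ a non-negative integer. Let $r_1,\ldots,r_m$ be positive divisors of $q^n-1$, and for each $i$ let $R_i$ be a positive divisor of $\frac{q^n-1}{r_i}$. Let $f,g\in\mathbb{F}_q[x]$ be monic divisors of $x^n-1$ with $\deg f=k$. For each $i\in\{1,\ldots,m\}$ let $\ell_i$ be a positive divisor of $R_i$, and let $\{p_{i,1},\ldots,p_{i,u(i)}\}$ be the set of all primes dividing $R_i$ but not dividing $\ell_i$. Let $\{h_1,\ldots,h_s\}$ be the set of all monic irreducible polynomials in $\mathbb{F}_q[x]$ dividing $x^n-1$ but not dividing $g$. Then for every $v\in\{1,\ldots,m\}$, $$N_v(R_1,\ldots,R_m,x^n-1)\ \ge\ \sum_{i=1}^m\sum_{j=1}^{u(i)} N_v(\ell_1,\ldots,\ell_{i-1},\ell_ip_{i,j},\ell_{i+1},\ldots,\ell_m,g)+\sum_{j=1}^s N_v(\ell_1,\ldots,\ell_m,gh_j)-\big(u(1)+\cdots+u(m)+s-1\big)N_v(\ell_1,\ldots,\ell_m,g).$$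
   Context: For $h=\sum_i a_ix^i\in\mathbb{F}_q[x]$ and $\gamma\in\mathbb{F}_{q^n}$, $h\circ\gamma=\sum_i a_i\gamma^{q^i}$. For a monic divisor $G$ of $x^n-1$, an element $\gamma\in\mathbb{F}_{q^n}$ is $G$-free if for every monic $h\mid G$ with $h\ne 1$ there is no $\delta\in\mathbb{F}_{q^n}$ with $\gamma=h\circ\delta$. For $r\mid q^n-1$ let $\mathcal{C}_r$ be the cyclic subgroup of $\mathbb{F}_{q^n}^*$ of order $\frac{q^n-1}{r}$, and for $S\mid\frac{q^n-1}{r}$, an element $\alpha\in\mathbb{F}_{q^n}^*$ is $(S,r)$-free if $\alpha\in\mathcal{C}_r$ and whenever $\alpha=\delta^t$ with $\delta\in\mathcal{C}_r$ and $t\mid S$, then $t=1$. For positive divisors $S_i$ of $\frac{q^n-1}{r_i}$ ($i=1,\ldots,m$), a monic divisor $G$ of $x^n-1$ and $v\in\{1,\ldots,m\}$, $N_v(S_1,\ldots,S_m,G)$ denotes the number of pairs $(\alpha,\gamma)\in\mathbb{F}_{q^n}^*\times\mathbb{F}_{q^n}$ such that $\alpha+(i-1)\beta$ is $(S_i,r_i)$-free for all $i\in\{1,\ldots,m\}$ and $\alpha+(v-1)\beta=f\circ\gamma$ with $\gamma$ being $G$-free (here $f$, $\beta$, $r_i$ are the fixed data of the statement). -}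

module Defs where

open import Level using (0ℓ)
open import Data.Nat as ℕ using (ℕ; zero; suc; _∸_; _≤_; _<_)
open import Data.Nat.DivMod using (_/_)
open import Data.Nat.Divisibility using (_∣_)
open import Data.Nat.Primality using (Prime)
open import Data.Fin as Fin using (Fin; toℕ)
open import Data.List as List using (List; []; _∷_; length; map; upTo; replicate; _++_; allFin)
open import Data.List.Membership.Propositional using (_∈_)
open import Data.List.Relation.Unary.Unique.Propositional using (Unique)
open import Data.Product using (Σ; ∃; _×_; _,_)
open import Relation.Nullary using (¬_; yes; no)
open import Relation.Binary.PropositionalEquality using (_≡_; _≢_)
open import Algebra.Structures using (IsCommutativeRing)
open import Function.Bundles using (_⇔_)

record FiniteField : Set₁ where
  infixl 6 _+_
  infixl 7 _*_
  field
    Carrier : Set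
    _+_ _*_ : Carrier → Carrier → Carrier
    -_      : Carrier → Carrier
    0# 1#   : Carrier
    isCommutativeRing : IsCommutativeRing _≡_ _+_ _*_ -_ 0# 1#
    0≢1     : 0# ≢ 1#
    inv     : Carrier → Carrier
    inv-r   : ∀ x → x ≢ 0# → x * inv x ≡ 1#
    elems   : List Carrier
    elems-unique   : Unique elems
    elems-complete : ∀ x → x ∈ elems

  _^_ : Carrier → ℕ → Carrier
  x ^ zero  = 1#
  x ^ suc n = x * (x ^ n)

  natK : ℕ → Carrier
  natK zero    = 0#
  natK (suc n) = 1# + natK n

  size : ℕ
  size = length elems

IsCharacteristic : FiniteField → ℕ → Set
IsCharacteristic K c = 0 < c × natK c ≡ 0# × (∀ d → 0 < d → d < c → natK d ≢ 0#)
  where open FiniteField K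

IsPrimePower : ℕ → Set
IsPrimePower q = ∃ λ p → ∃ λ e → Prime p × 1 ≤ e × q ≡ p ℕ.^ e

-- quotient a / r (r is always a positive divisor where used)
quot : ℕ → ℕ → ℕ
quot a zero    = 0
quot a (suc r) = a / suc r

IsCountOf : {A : Set} → (A → Set) → ℕ → Set
IsCountOf {A} P c = Σ (List A) λ L → Unique L × (∀ x → (x ∈ L) ⇔ P x) × length L ≡ c

update : ∀ {m} → (Fin m → ℕ) → Fin m → ℕ → Fin m → ℕ
update S i x j with j Fin.≟ i
... | yes _ = x
... | no  _ = S j

module _ (K : FiniteField) (q : ℕ) where
  open FiniteField K

  -- the subfield F_q of K (|K| = q^n): elements with a^q = a
  InFq : Carrier → Set
  InFq a = a ^ q ≡ a

  -- polynomials are coefficient lists, lowest degree first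
  Poly : Set
  Poly = List Carrier

  PolyOverFq : Poly → Set
  PolyOverFq [] = ⊤'
    where open import Data.Unit using () renaming (⊤ to ⊤')
  PolyOverFq (a ∷ as) = InFq a × PolyOverFq as

  coeff : Poly → ℕ → Carrier
  coeff []       _       = 0#
  coeff (a ∷ as) zero    = a
  coeff (a ∷ as) (suc i) = coeff as i

  -- equality of polynomials (ignoring trailing zeros)
  _≈P_ : Poly → Poly → Set
  p ≈P r = ∀ i → coeff p i ≡ coeff r i

  conv : Poly → Poly → ℕ → Carrier
  conv p r i = List.foldr _+_ 0# (map (λ j → coeff p j * coeff r (i ∸ j)) (upTo (suc i)))

  _*P_ : Poly → Poly → Poly
  p *P r = map (conv p r) (upTo (length p ℕ.+ length r ∸ 1))

  lastIs1 : Poly → Set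
  lastIs1 []           = 0# ≡ 1#
  lastIs1 (a ∷ [])     = a ≡ 1#
  lastIs1 (a ∷ b ∷ as) = lastIs1 (b ∷ as)

  MonicFq : Poly → Set
  MonicFq h = PolyOverFq h × lastIs1 h

  _∣P_ : Poly → Poly → Set
  h ∣P G = Σ Poly λ t → PolyOverFq t × (h *P t) ≈P G

  oneP : Poly
  oneP = 1# ∷ []

  xⁿ-1 : ℕ → Poly
  xⁿ-1 n = (- 1#) ∷ (replicate (n ∸ 1) 0# ++ (1# ∷ []))

  IrreducibleFq : Poly → Set
  IrreducibleFq h = MonicFq h × 2 ≤ length h ×
    (∀ d → MonicFq d → d ∣P h → d ≈P oneP ⊎' d ≈P h)
    where open import Data.Sum using () renaming (_⊎_ to _⊎'_)

  linFrom : ℕ → Poly → Carrier → Carrier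
  linFrom i []       γ = 0#
  linFrom i (a ∷ as) γ = a * (γ ^ (q ℕ.^ i)) + linFrom (suc i) as γ

  _∘L_ : Poly → Carrier → Carrier
  h ∘L γ = linFrom 0 h γ

  GFree : Poly → Carrier → Set
  GFree G γ = ∀ h → MonicFq h → h ∣P G → ¬ (h ≈P oneP) → ¬ (∃ λ δ → γ ≡ h ∘L δ)

  module _ (n : ℕ) where
    Qn-1 : ℕ
    Qn-1 = q ℕ.^ n ∸ 1

    -- membership in C_r, the cyclic subgroup of K^* of order (q^n-1)/r
    -- (= the nonzero elements whose order divides (q^n-1)/r)
    InC : ℕ → Carrier → Set
    InC r x = x ≢ 0# × x ^ quot Qn-1 r ≡ 1#

    SrFree : ℕ → ℕ → Carrier → Set
    SrFree S r α = InC r α × (∀ δ t → InC r δ → t ∣ S → α ≡ δ ^ t → t ≡ 1)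

    NvPred : (m : ℕ) (β : Carrier) (r : Fin m → ℕ) (f : Poly) (v : Fin m)
             (S : Fin m → ℕ) (G : Poly) → Carrier × Carrier → Set
    NvPred m β r f v S G (α , γ) =
      α ≢ 0# ×
      (∀ i → SrFree (S i) (r i) (α + natK (toℕ i) * β)) ×
      (α + natK (toℕ v) * β ≡ f ∘L γ) ×
      GFree G γ

{-# OPTIONS --safe #-}
-- The pairs counted by N_v(ℓ, g) form a finite set A, and each sieving index
-- (a prime p ∣ R_i with p ∤ ℓ_i, or an irreducible h ∣ xⁿ - 1 with h ∤ g) gives the
-- subset of A counted after replacing ℓ_i by ℓ_i p, resp. g by g h.  A pair lying in
-- all of these subsets is counted by N_v(R, xⁿ - 1): an exponent t ∣ R_i with t ≠ 1
-- has a prime factor, and a nontrivial divisor of xⁿ - 1 has an irreducible factor,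
-- through which any witness of non-freeness factors, because (d e) ∘ δ = d ∘ (e ∘ δ)
-- for e over F_q (additivity of the Frobenius x ↦ x^q).  The elementary sieve
-- bound |⋂ X_j| ≥ Σ |X_j| - (s - 1) |A| for s subsets X_j ⊆ A then gives the claim.

module Submission where

open import Defs
open import Data.Nat as ℕ using (ℕ; suc; _∸_; _≤_; _<_)
open import Data.Nat.Divisibility using (_∣_)
open import Data.Nat.Primality using (Prime)
open import Data.Fin using (Fin)
open import Data.List using (List; length; map; allFin)
open import Data.Nat.ListAction using (sum)
open import Data.List.Membership.Propositional using (_∈_)
open import Data.List.Relation.Unary.Unique.Propositional using (Unique)
open import Data.Product using (_×_)
open import Relation.Nullary using (¬_)
open import Relation.Binary.PropositionalEquality using (_≡_; _≢_)
open import Function.Bundles using (_⇔_)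
open import Data.Integer as ℤ using (ℤ; +_)

open import Level using (0ℓ)
open import Data.Nat using (zero; z≤n; s≤s)
open import Data.Nat.Base using (_!)
import Data.Nat.Properties as ℕ
open import Data.Nat.Properties using (_!*_!≢0)
open import Data.Nat.Divisibility using (divides; ∣-trans; ∣-refl; m∣m*n; n∣m*n; _∣?_; 0∣⇒≡0; ∣1⇒≡1; ∣⇒≤)
open import Data.Nat.Primality using (prime⇒nonZero; prime⇒nonTrivial; euclidsLemma)
open import Data.Nat.Primality.Factorisation using (factorise)
open import Data.Nat.Combinatorics using (_C_; nCn≡1; nCk≡nC[n∸k]; nCk≡n!/k![n-k]!; k![n∸k]!∣n!)
open import Data.Nat.DivMod using (m/n*n≡m)
open import Data.Nat.ListAction.Properties using (sum-++)
import Data.Nat.Tactic.RingSolver as ℕ-Solver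
import Data.Integer.Properties as ℤ
import Data.Integer.Tactic.RingSolver as ℤ-Solver
open import Data.Fin as Fin using (toℕ; inject₁; fromℕ)
import Data.Fin.Properties as Fin
open import Data.List using ([]; _∷_; _++_; lookup; filter; foldr; upTo; applyUpTo; concatMap)
open import Data.List.Properties using (length-++; length-map; length-applyUpTo; map-∘; map-cong; map-++)
import Data.List.Relation.Unary.Any as Any
open import Data.List.Relation.Unary.Any.Properties using (lookup-index)
open import Data.List.Relation.Unary.All as All using (All; []; _∷_)
import Data.List.Relation.Unary.All.Properties as All
open import Data.List.Relation.Unary.AllPairs using ([]; _∷_)
import Data.List.Relation.Unary.Unique.Propositional.Properties as Unique
open import Data.List.Membership.Propositional.Properties
  using (∈-lookup; ∈-filter⁺; ∈-++⁺ˡ; ∈-++⁺ʳ; ∈-++⁻; ∈-map⁺; ∈-map⁻;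
         ∈-concatMap⁺; ∈-concatMap⁻; ∈-allFin)
open import Data.List.Membership.Propositional.Properties.WithK using (unique∧set⇒bag)
import Data.List.Membership.DecPropositional as DecMembership
open import Data.List.Relation.Binary.Subset.Propositional using (_⊆_)
open import Data.List.Relation.Binary.BagAndSetEquality using (∼bag⇒↭)
open import Data.List.Relation.Binary.Permutation.Propositional using (_↭_; ↭⇒↭ₛ′)
import Data.List.Relation.Binary.Permutation.Setoid.Properties as PermutationProperties
open import Data.Product using (Σ; ∃; _,_; proj₁; proj₂; uncurry)
open import Data.Product.Properties using (≡-dec)
open import Data.Sum using (_⊎_; inj₁; inj₂)
open import Data.Unit using (tt)
open import Data.Empty using (⊥-elim)
open import Data.Bool using (true; false)
open import Relation.Nullary using (Dec; yes; no; does)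
open import Relation.Unary using (Pred; Decidable)
open import Relation.Unary.Properties using (∁?)
open import Relation.Binary.Definitions using (DecidableEquality)
open import Relation.Binary.PropositionalEquality
  using (refl; sym; trans; cong; cong₂; subst; subst₂; setoid; isEquivalence; module ≡-Reasoning)
open import Function using (_∘_; Equivalence; mk⇔)
open import Algebra.Bundles using (CommutativeRing)
import Algebra.Properties.CommutativeSemigroup as CommutativeSemigroupProperties
import Algebra.Properties.Group as GroupProperties
import Algebra.Properties.CommutativeSemiring.Exp as ExpProperties
import Algebra.Properties.CommutativeSemiring.Binomial as Binomial
import Algebra.Properties.Semiring.Mult as SemiringMultProperties
import Algebra.Properties.Monoid.Sum as SumProperties

module _ {A : Set} where
  open Data.Nat using (_+_)

  lookup-injective : {xs : List A} → Unique xs → ∀ {i j} → lookup xs i ≡ lookup xs j → i ≡ j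
  lookup-injective (_ ∷ _) {Fin.zero} {Fin.zero} _ = refl
  lookup-injective (x∉ ∷ _) {Fin.zero} {Fin.suc j} eq = ⊥-elim (All.lookup x∉ (∈-lookup j) eq)
  lookup-injective (x∉ ∷ _) {Fin.suc i} {Fin.zero} eq = ⊥-elim (All.lookup x∉ (∈-lookup i) (sym eq))
  lookup-injective (_ ∷ u) {Fin.suc i} {Fin.suc j} eq = cong Fin.suc (lookup-injective u eq)

  Unique-⊆⇒length≤ : {xs ys : List A} → Unique xs → xs ⊆ ys → length xs ≤ length ys
  Unique-⊆⇒length≤ {xs} {ys} u xs⊆ys with length ys ℕ.<? length xs
  ... | no ys≮xs = ℕ.≮⇒≥ ys≮xs
  ... | yes ys<xs with i , j , i<j , same ← Fin.pigeonhole ys<xs (λ i → Any.index (xs⊆ys (∈-lookup i))) =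
    ⊥-elim (Fin.<⇒≢ i<j (lookup-injective u
      (trans (lookup-index (xs⊆ys (∈-lookup i)))
        (trans (cong (lookup ys) same) (sym (lookup-index (xs⊆ys (∈-lookup j))))))))

  enumeration⇒≟ : (xs : List A) → (∀ x → x ∈ xs) → DecidableEquality A
  enumeration⇒≟ xs complete x y with Any.index (complete x) Fin.≟ Any.index (complete y)
  ... | yes same = yes (trans (lookup-index (complete x)) (trans (cong (lookup xs) same) (sym (lookup-index (complete y)))))
  ... | no differ = no λ { refl → differ refl }

  length-filter+length-filter-∁ : ∀ {ℓ} {P : Pred A ℓ} (P? : Decidable P) (xs : List A) →
                                  length (filter P? xs) + length (filter (∁? P?) xs) ≡ length xs
  length-filter+length-filter-∁ P? [] = refl
  length-filter+length-filter-∁ P? (x ∷ xs) with does (P? x)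
  ... | true  = cong suc (length-filter+length-filter-∁ P? xs)
  ... | false = trans (ℕ.+-suc _ _) (cong suc (length-filter+length-filter-∁ P? xs))

sum-map-concatMap : {A B : Set} (N : B → ℕ) (F : A → List B) (xs : List A) →
                    sum (map N (concatMap F xs)) ≡ sum (map (λ x → sum (map N (F x))) xs)
sum-map-concatMap N F []       = refl
sum-map-concatMap N F (x ∷ xs) =
  trans (cong sum (map-++ N (F x) (concatMap F xs)))
        (trans (sum-++ (map N (F x)) _) (cong (sum (map N (F x)) ℕ.+_) (sum-map-concatMap N F xs)))

length-concatMap : {A B : Set} (F : A → List B) (xs : List A) → length (concatMap F xs) ≡ sum (map (length ∘ F) xs)
length-concatMap F []       = refl
length-concatMap F (x ∷ xs) = trans (length-++ (F x)) (cong (length (F x) ℕ.+_) (length-concatMap F xs))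

module Sieve {E : Set} (_≟_ : DecidableEquality E) where
  open DecMembership _≟_ using (_∈?_; _∉?_)
  open Data.Nat using (_+_; _*_)

  private
    sieve-arithmetic : ∀ {x s a t f k} → s + a ≤ (t + f) + k → x + f ≤ a → (x + s) + a ≤ t + (a + k)
    sieve-arithmetic {x} {s} {a} {t} {f} {k} ih bound = begin
      (x + s) + a       ≡⟨ ℕ.+-assoc x s a ⟩
      x + (s + a)       ≤⟨ ℕ.+-monoʳ-≤ x ih ⟩
      x + ((t + f) + k) ≡⟨ regroup x t f k ⟩
      t + ((x + f) + k) ≤⟨ ℕ.+-monoʳ-≤ t (ℕ.+-monoˡ-≤ k bound) ⟩
      t + (a + k)       ∎
      where
      open ℕ.≤-Reasoning
      regroup : ∀ x t f k → x + ((t + f) + k) ≡ t + ((x + f) + k)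
      regroup = ℕ-Solver.solve-∀

  -- Induction on Xs: enlarging T by A ∖ X drops X from the family.
  length-sieve : (A T : List E) (Xs : List (List E)) → Unique A →
                 All (λ X → Unique X × X ⊆ A) Xs →
                 (∀ {a} → a ∈ A → All (a ∈_) Xs → a ∈ T) →
                 sum (map length Xs) + length A ≤ length T + length Xs * length A
  length-sieve A T [] uA _ covers =
    subst₂ _≤_ refl (sym (ℕ.+-identityʳ _)) (Unique-⊆⇒length≤ uA (λ a∈A → covers a∈A []))
  length-sieve A T (X ∷ Xs) uA ((uX , X⊆A) ∷ Xs⊆A) covers =
    sieve-arithmetic {t = length T} {k = length Xs * length A} (subst₂ _≤_ refl (cong (_+ _) (length-++ T)) ih) bound
    where
    outsideX : List E
    outsideX = filter (_∉? X) A
    covers′ : ∀ {a} → a ∈ A → All (a ∈_) Xs → a ∈ T ++ outsideX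
    covers′ {a} a∈A a∈Xs with a ∈? X
    ... | yes a∈X = ∈-++⁺ˡ (covers a∈A (a∈X ∷ a∈Xs))
    ... | no  a∉X = ∈-++⁺ʳ T (∈-filter⁺ (_∉? X) a∈A a∉X)
    ih : sum (map length Xs) + length A ≤ length (T ++ outsideX) + length Xs * length A
    ih = length-sieve A (T ++ outsideX) Xs uA Xs⊆A covers′
    bound : length X + length outsideX ≤ length A
    bound = ℕ.≤-trans
      (ℕ.+-monoˡ-≤ _ (Unique-⊆⇒length≤ uX (λ x∈X → ∈-filter⁺ (_∈? X) (X⊆A x∈X) x∈X)))
      (ℕ.≤-reflexive (length-filter+length-filter-∁ (_∈? X) A))

  count-sieve : {J : Set} {P T : E → Set} {nP nT : ℕ} (js : List J) (Q : J → E → Set) (N : J → ℕ) →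
                IsCountOf P nP → IsCountOf T nT → (∀ j → IsCountOf (Q j) (N j)) →
                (∀ j → j ∈ js → ∀ {x} → Q j x → P x) →
                (∀ {x} → P x → (∀ j → j ∈ js → Q j x) → T x) →
                sum (map N js) + nP ≤ nT + length js * nP
  count-sieve {J} js Q N (LP , uP , ∈LP , refl) (LT , _ , ∈LT , refl) countQ Q⇒P P∧Q⇒T =
    subst₂ _≤_
      (cong (_+ length LP) (cong sum (trans (sym (map-∘ js)) (map-cong lengthL js))))
      (cong (λ k → length LT + k * length LP) (length-map L js))
      (length-sieve LP LT (map L js) uP
        (All.map⁺ (All.tabulate λ {j} j∈js → uniqueL j , λ x∈ → from (∈LP _) (Q⇒P j j∈js (to (∈L j) x∈))))
        (λ a∈LP a∈Ls → from (∈LT _) (P∧Q⇒T (to (∈LP _) a∈LP)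
          (λ j j∈ → to (∈L j) (All.lookup (All.map⁻ a∈Ls) j∈)))))
    where
    open Equivalence
    L : J → List E
    L j = proj₁ (countQ j)
    uniqueL : ∀ j → Unique (L j)
    uniqueL j = proj₁ (proj₂ (countQ j))
    ∈L : ∀ j {x} → (x ∈ L j) ⇔ Q j x
    ∈L j {x} = proj₁ (proj₂ (proj₂ (countQ j))) x
    lengthL : ∀ j → length (L j) ≡ N j
    lengthL j = proj₂ (proj₂ (proj₂ (countQ j)))

ℕ-bound⇒ℤ-bound : ∀ {a b n s t} → a ℕ.+ b ℕ.+ n ≤ t ℕ.+ s ℕ.* n →
                  + t ℤ.≥ (+ a ℤ.+ + b) ℤ.- ((+ s ℤ.- + 1) ℤ.* + n)
ℕ-bound⇒ℤ-bound {a} {b} {n} {s} {t} a+b+n≤t+sn = subst (ℤ._≤ + t) (sym rearranged) bound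
  where
  regroup : ∀ a b n s → (a ℤ.+ b) ℤ.- ((s ℤ.- ℤ.1ℤ) ℤ.* n) ≡ ((a ℤ.+ b) ℤ.+ n) ℤ.- s ℤ.* n
  regroup = ℤ-Solver.solve-∀
  cancel : ∀ x y → (x ℤ.+ y) ℤ.- y ≡ x
  cancel = ℤ-Solver.solve-∀
  rearranged : (+ a ℤ.+ + b) ℤ.- ((+ s ℤ.- + 1) ℤ.* + n) ≡ + (a ℕ.+ b ℕ.+ n) ℤ.- + (s ℕ.* n)
  rearranged = trans (regroup (+ a) (+ b) (+ n) (+ s)) (cong (λ x → (+ a ℤ.+ + b ℤ.+ + n) ℤ.- x) (sym (ℤ.pos-* s n)))
  bound : + (a ℕ.+ b ℕ.+ n) ℤ.- + (s ℕ.* n) ℤ.≤ + t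
  bound = subst (_ ℤ.≤_) (cancel (+ t) (+ (s ℕ.* n))) (ℤ.+-monoˡ-≤ (ℤ.- + (s ℕ.* n)) (ℤ.+≤+ a+b+n≤t+sn))

prime∤n! : ∀ {p} → Prime p → ∀ n → n < p → ¬ p ∣ n !
prime∤n! p-prime zero    _   p∣1 = ℕ.nonTrivial⇒≢1 {{prime⇒nonTrivial p-prime}} (∣1⇒≡1 p∣1)
prime∤n! p-prime (suc n) n<p p∣n! with euclidsLemma (suc n) (n !) p-prime p∣n!
... | inj₁ p∣1+n = ℕ.<⇒≱ n<p (∣⇒≤ p∣1+n)
... | inj₂ p∣n!  = prime∤n! p-prime n (ℕ.<-trans (ℕ.n<1+n n) n<p) p∣n!

prime∣pCk : ∀ {p k} → Prime p → 0 < k → k < p → p ∣ p C k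
prime∣pCk {p} {k} p-prime 0<k k<p
  with euclidsLemma (p C k) (k ! ℕ.* (p ∸ k) !) p-prime p∣pCk*k![p∸k]!
  where
  instance _ = k !* (p ∸ k) !≢0
  p∣pCk*k![p∸k]! : p ∣ (p C k) ℕ.* (k ! ℕ.* (p ∸ k) !)
  p∣pCk*k![p∸k]! = subst (p ∣_)
    (sym (trans (cong (ℕ._* (k ! ℕ.* (p ∸ k) !)) (nCk≡n!/k![n-k]! (ℕ.<⇒≤ k<p)))
                (m/n*n≡m (k![n∸k]!∣n! (ℕ.<⇒≤ k<p)))))
    (n∣n! (ℕ.<-trans 0<k k<p))
    where
    n∣n! : ∀ {n} → 0 < n → n ∣ n !
    n∣n! {suc n} _ = m∣m*n (n !)
... | inj₁ p∣pCk = p∣pCk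
... | inj₂ p∣k!*[p∸k]! with euclidsLemma (k !) ((p ∸ k) !) p-prime p∣k!*[p∸k]!
...   | inj₁ p∣k!     = ⊥-elim (prime∤n! p-prime k k<p p∣k!)
...   | inj₂ p∣[p∸k]! = ⊥-elim (prime∤n! p-prime (p ∸ k) (ℕ.∸-monoʳ-< {p} {k} {0} 0<k (ℕ.<⇒≤ k<p)) p∣[p∸k]!)

primeDivisor : ∀ {t} → t ≢ 0 → t ≢ 1 → ∃ λ p → Prime p × p ∣ t
primeDivisor {t} t≢0 t≢1 with factorise t {{ℕ.≢-nonZero t≢0}}
... | record { factors = [] ; isFactorisation = t≡1 } = ⊥-elim (t≢1 t≡1)
... | record { factors = p ∷ ps ; isFactorisation = t≡∏ ; factorsPrime = p-prime ∷ _ } =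
  p , p-prime , subst (p ∣_) (sym t≡∏) (m∣m*n _)

divisor≢0 : ∀ {m n} → 0 < n → m ∣ n → m ≢ 0
divisor≢0 0<n m∣n refl = ℕ.<⇒≢ 0<n (sym (0∣⇒≡0 m∣n))

IsPrimePower⇒1≤ : ∀ {q} → IsPrimePower q → 1 ≤ q
IsPrimePower⇒1≤ (p , e , p-prime , _ , refl) = ℕ.m^n>0 p {{prime⇒nonZero p-prime}} e

module FieldProperties (K : FiniteField) where
  open FiniteField K public

  commutativeRing : CommutativeRing 0ℓ 0ℓ
  commutativeRing = record { isCommutativeRing = isCommutativeRing }

  open CommutativeRing commutativeRing public
    using (+-assoc; +-comm; +-identityˡ; +-identityʳ;
           *-assoc; *-comm; *-identityˡ; *-identityʳ; distribˡ; distribʳ; zeroˡ; zeroʳ;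
           +-isCommutativeMonoid)
  open CommutativeRing commutativeRing
    using (commutativeSemiring; semiring; +-monoid; +-group; +-commutativeSemigroup)
  open ≡-Reasoning

  _≟_ : DecidableEquality Carrier
  _≟_ = enumeration⇒≟ elems elems-complete

  +-interchange : ∀ a b c d → (a + b) + (c + d) ≡ (a + c) + (b + d)
  +-interchange = CommutativeSemigroupProperties.interchange +-commutativeSemigroup

  1≢0 : 1# ≢ 0#
  1≢0 1≡0 = 0≢1 (sym 1≡0)

  x*y≢0 : ∀ {x y} → x ≢ 0# → y ≢ 0# → x * y ≢ 0#
  x*y≢0 {x} {y} x≢0 y≢0 xy≡0 = y≢0 (begin
    y               ≡⟨ *-identityˡ y ⟨
    1# * y          ≡⟨ cong (_* y) (trans (*-comm (inv x) x) (inv-r x x≢0)) ⟨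
    (inv x * x) * y ≡⟨ *-assoc (inv x) x y ⟩
    inv x * (x * y) ≡⟨ cong (inv x *_) xy≡0 ⟩
    inv x * 0#      ≡⟨ zeroʳ (inv x) ⟩
    0#              ∎)

  x^n≢0 : ∀ {x} n → x ≢ 0# → x ^ n ≢ 0#
  x^n≢0 zero    _   = 1≢0
  x^n≢0 (suc n) x≢0 = x*y≢0 x≢0 (x^n≢0 n x≢0)

  module Exp = ExpProperties commutativeSemiring

  ^≗Exp^ : ∀ x n → x ^ n ≡ x Exp.^ n
  ^≗Exp^ x zero    = refl
  ^≗Exp^ x (suc n) = cong (x *_) (^≗Exp^ x n)

  ^-assocʳ : ∀ x m n → (x ^ m) ^ n ≡ x ^ (m ℕ.* n)
  ^-assocʳ x m n = begin
    (x ^ m) ^ n               ≡⟨ trans (^≗Exp^ (x ^ m) n) (cong (Exp._^ n) (^≗Exp^ x m)) ⟩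
    (x Exp.^ m) Exp.^ n       ≡⟨ Exp.^-assocʳ x m n ⟩
    x Exp.^ (m ℕ.* n)         ≡⟨ ^≗Exp^ x (m ℕ.* n) ⟨
    x ^ (m ℕ.* n)             ∎

  ^-distrib-* : ∀ x y n → (x * y) ^ n ≡ x ^ n * y ^ n
  ^-distrib-* x y n = begin
    (x * y) ^ n               ≡⟨ ^≗Exp^ (x * y) n ⟩
    (x * y) Exp.^ n           ≡⟨ Exp.^-distrib-* x y n ⟩
    x Exp.^ n * y Exp.^ n     ≡⟨ cong₂ _*_ (^≗Exp^ x n) (^≗Exp^ y n) ⟨
    x ^ n * y ^ n             ∎

  ^-comm : ∀ x m n → (x ^ m) ^ n ≡ (x ^ n) ^ m
  ^-comm x m n = trans (^-assocʳ x m n) (trans (cong (x ^_) (ℕ.*-comm m n)) (sym (^-assocʳ x n m)))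

  1^n≡1 : ∀ n → 1# ^ n ≡ 1#
  1^n≡1 zero    = refl
  1^n≡1 (suc n) = trans (*-identityˡ _) (1^n≡1 n)

  0^n≡0 : ∀ n → 1 ≤ n → 0# ^ n ≡ 0#
  0^n≡0 (suc n) _ = zeroˡ _

  module Mult = SemiringMultProperties semiring

  natK≗×1 : ∀ n → natK n ≡ n Mult.× 1#
  natK≗×1 zero    = refl
  natK≗×1 (suc n) = cong (_+_ 1#) (natK≗×1 n)

  natK-* : ∀ m n → natK (m ℕ.* n) ≡ natK m * natK n
  natK-* m n = begin
    natK (m ℕ.* n)              ≡⟨ natK≗×1 (m ℕ.* n) ⟩
    (m ℕ.* n) Mult.× 1#         ≡⟨ Mult.×1-homo-* m n ⟩
    m Mult.× 1# * n Mult.× 1#   ≡⟨ cong₂ _*_ (natK≗×1 m) (natK≗×1 n) ⟨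
    natK m * natK n             ∎

  natK-^ : ∀ m n → natK (m ℕ.^ n) ≡ natK m ^ n
  natK-^ m zero    = +-identityʳ 1#
  natK-^ m (suc n) = trans (natK-* m (m ℕ.^ n)) (cong (natK m *_) (natK-^ m n))

  ×≗natK* : ∀ n x → n Mult.× x ≡ natK n * x
  ×≗natK* n x = begin
    n Mult.× x          ≡⟨ cong (n Mult.×_) (*-identityˡ x) ⟨
    n Mult.× (1# * x)   ≡⟨ Mult.×-assoc-* n 1# x ⟨
    n Mult.× 1# * x     ≡⟨ cong (_* x) (natK≗×1 n) ⟨
    natK n * x          ∎

  ∑ : List Carrier → Carrier
  ∑ = foldr _+_ 0#

  ∑-map-+1 : ∀ xs → ∑ (map (_+ 1#) xs) ≡ ∑ xs + natK (length xs)
  ∑-map-+1 []       = sym (+-identityˡ 0#)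
  ∑-map-+1 (x ∷ xs) = trans (cong (_+_ (x + 1#)) (∑-map-+1 xs)) (+-interchange x 1# (∑ xs) _)

  -- x ↦ x + 1 permutes K, so Σ x = Σ (x + 1) = Σ x + |K| · 1.
  natK-size≡0 : natK size ≡ 0#
  natK-size≡0 = GroupProperties.identityʳ-unique +-group (∑ elems) (natK size) (begin
    ∑ elems + natK size    ≡⟨ ∑-map-+1 elems ⟨
    ∑ (map (_+ 1#) elems)  ≡⟨ foldr-commMonoid +-isCommutativeMonoid (↭⇒↭ₛ′ isEquivalence shifted↭elems) ⟩
    ∑ elems                ∎)
    where
    open PermutationProperties (setoid Carrier) using (foldr-commMonoid)
    +1-injective : ∀ {x y} → x + 1# ≡ y + 1# → x ≡ y
    +1-injective {x} {y} = GroupProperties.∙-cancelʳ +-group 1# x y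
    shifted↭elems : map (_+ 1#) elems ↭ elems
    shifted↭elems = ∼bag⇒↭ (unique∧set⇒bag (Unique.map⁺ +1-injective elems-unique) elems-unique
      (λ {x} → mk⇔ (λ _ → elems-complete x)
           (λ _ → subst (_∈ map (_+ 1#) elems) (GroupProperties.//-rightDividesˡ +-group 1# x)
                        (∈-map⁺ (_+ 1#) (elems-complete (x + - 1#))))))

  natK-∣ : ∀ {p n} → natK p ≡ 0# → p ∣ n → natK n ≡ 0#
  natK-∣ {p} p≡0 (divides m refl) = trans (natK-* m p) (trans (cong (natK m *_) p≡0) (zeroʳ (natK m)))

  frobenius-prime : ∀ {p} → Prime p → natK p ≡ 0# → ∀ x y → (x + y) ^ p ≡ x ^ p + y ^ p
  frobenius-prime {suc p′} p-prime p≡0 x y = begin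
    (x + y) ^ p
      ≡⟨ ^≗Exp^ (x + y) p ⟩
    (x + y) Exp.^ p
      ≡⟨ Bin.theorem p x y ⟩
    term Fin.zero + Sum.sum (term ∘ Fin.suc)
      ≡⟨ cong (_+_ (term Fin.zero)) (Sum.sum-init-last (term ∘ Fin.suc)) ⟩
    term Fin.zero + (Sum.sum inner + term (fromℕ p))
      ≡⟨ cong (λ s → term Fin.zero + (s + term (fromℕ p))) inner≡0 ⟩
    term Fin.zero + (0# + term (fromℕ p))
      ≡⟨ cong₂ _+_ first (trans (+-identityˡ _) last) ⟩
    y ^ p + x ^ p
      ≡⟨ +-comm (y ^ p) (x ^ p) ⟩
    x ^ p + y ^ p ∎
    where
    module Bin = Binomial commutativeSemiring
    module Sum = SumProperties +-monoid
    p : ℕ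
    p = suc p′
    term : Fin (suc p) → Carrier
    term = Bin.binomialTerm x y p
    inner : Fin p′ → Carrier
    inner i = term (Fin.suc (inject₁ i))
    inner≡0 : Sum.sum inner ≡ 0#
    inner≡0 = trans (Sum.sum-cong-≗ vanish) (Sum.sum-replicate-zero p′)
      where
      vanish : ∀ i → inner i ≡ 0#
      vanish i = trans (×≗natK* (p C k) binomial)
                   (trans (cong (_* binomial) (natK-∣ p≡0 (prime∣pCk p-prime (s≤s z≤n) k<p))) (zeroˡ binomial))
        where
        k : ℕ
        k = suc (toℕ (inject₁ i))
        binomial : Carrier
        binomial = Bin.binomial x y p (Fin.suc (inject₁ i))
        k<p : k < p
        k<p = s≤s (subst (_< p′) (sym (Fin.toℕ-inject₁ i)) (Fin.toℕ<n i))
    first : term Fin.zero ≡ y ^ p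
    first = begin
      (p C 0) Mult.× (1# * y Exp.^ p)
        ≡⟨ cong (Mult._× (1# * y Exp.^ p)) (trans (nCk≡nC[n∸k] {0} {p} z≤n) (nCn≡1 p)) ⟩
      1 Mult.× (1# * y Exp.^ p)
        ≡⟨ Mult.×-homo-1 _ ⟩
      1# * y Exp.^ p
        ≡⟨ *-identityˡ _ ⟩
      y Exp.^ p
        ≡⟨ ^≗Exp^ y p ⟨
      y ^ p ∎
    last : term (fromℕ p) ≡ x ^ p
    last = begin
      term (fromℕ p)
        ≡⟨ cong (λ k → (p C k) Mult.× (x Exp.^ k * y Exp.^ (p ∸ k))) (Fin.toℕ-fromℕ p) ⟩
      (p C p) Mult.× (x Exp.^ p * y Exp.^ (p ∸ p))
        ≡⟨ cong₂ (λ c e → c Mult.× (x Exp.^ p * y Exp.^ e)) (nCn≡1 p) (ℕ.n∸n≡0 p) ⟩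
      1 Mult.× (x Exp.^ p * 1#)
        ≡⟨ Mult.×-homo-1 _ ⟩
      x Exp.^ p * 1#
        ≡⟨ *-identityʳ _ ⟩
      x Exp.^ p
        ≡⟨ ^≗Exp^ x p ⟨
      x ^ p ∎

  frobenius-primePower : ∀ {p} e → Prime p → natK p ≡ 0# →
                         ∀ x y → (x + y) ^ (p ℕ.^ e) ≡ x ^ (p ℕ.^ e) + y ^ (p ℕ.^ e)
  frobenius-primePower zero p-prime p≡0 x y =
    trans (*-identityʳ (x + y)) (cong₂ _+_ (sym (*-identityʳ x)) (sym (*-identityʳ y)))
  frobenius-primePower {p} (suc e) p-prime p≡0 x y = begin
    (x + y) ^ (p ℕ.* p ℕ.^ e)                    ≡⟨ ^-assocʳ (x + y) p (p ℕ.^ e) ⟨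
    ((x + y) ^ p) ^ (p ℕ.^ e)                    ≡⟨ cong (_^ (p ℕ.^ e)) (frobenius-prime p-prime p≡0 x y) ⟩
    (x ^ p + y ^ p) ^ (p ℕ.^ e)                  ≡⟨ frobenius-primePower e p-prime p≡0 (x ^ p) (y ^ p) ⟩
    (x ^ p) ^ (p ℕ.^ e) + (y ^ p) ^ (p ℕ.^ e)    ≡⟨ cong₂ _+_ (^-assocʳ x p (p ℕ.^ e)) (^-assocʳ y p (p ℕ.^ e)) ⟩
    x ^ (p ℕ.* p ℕ.^ e) + y ^ (p ℕ.* p ℕ.^ e)    ∎

  natK-characteristic≡0 : ∀ {q n p e} → size ≡ q ℕ.^ n → q ≡ p ℕ.^ e → natK p ≡ 0#
  natK-characteristic≡0 {q} {n} {p} {e} size≡q^n q≡p^e with natK p ≟ 0#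
  ... | yes p≡0 = p≡0
  ... | no  p≢0 = ⊥-elim (x^n≢0 (e ℕ.* n) p≢0 (begin
    natK p ^ (e ℕ.* n)      ≡⟨ natK-^ p (e ℕ.* n) ⟨
    natK (p ℕ.^ (e ℕ.* n))  ≡⟨ cong natK (ℕ.^-*-assoc p e n) ⟨
    natK ((p ℕ.^ e) ℕ.^ n)  ≡⟨ cong (λ q → natK (q ℕ.^ n)) q≡p^e ⟨
    natK (q ℕ.^ n)          ≡⟨ cong natK size≡q^n ⟨
    natK size               ≡⟨ natK-size≡0 ⟩
    0#                      ∎))

  frobenius : ∀ {q n} → IsPrimePower q → size ≡ q ℕ.^ n → ∀ x y → (x + y) ^ q ≡ x ^ q + y ^ q
  frobenius {n = n} (p , e , p-prime , _ , refl) size≡q^n =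
    frobenius-primePower e p-prime (natK-characteristic≡0 {n = n} {p} {e} size≡q^n refl)

module Polynomials (K : FiniteField) (q : ℕ) (1≤q : 1 ≤ q)
                   (frobenius : ∀ x y → FiniteField._^_ K (FiniteField._+_ K x y) q ≡
                                        FiniteField._+_ K (FiniteField._^_ K x q) (FiniteField._^_ K y q)) where
  open FieldProperties K hiding (frobenius)
  open ≡-Reasoning

  Polynomial : Set
  Polynomial = Poly K q

  infix  4 _≈ₚ_ _∣ₚ_
  infixl 7 _*ₚ_

  _≈ₚ_ : Polynomial → Polynomial → Set
  _≈ₚ_ = _≈P_ K q

  _*ₚ_ : Polynomial → Polynomial → Polynomial
  _*ₚ_ = _*P_ K q

  _∣ₚ_ : Polynomial → Polynomial → Set
  _∣ₚ_ = _∣P_ K q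

  c : Polynomial → ℕ → Carrier
  c = coeff K q

  1ₚ : Polynomial
  1ₚ = oneP K q

  sumTo : ℕ → (ℕ → Carrier) → Carrier
  sumTo zero    f = 0#
  sumTo (suc n) f = f 0 + sumTo n (λ i → f (suc i))

  sumTo-cong : ∀ n {f g} → (∀ i → i < n → f i ≡ g i) → sumTo n f ≡ sumTo n g
  sumTo-cong zero    f≡g = refl
  sumTo-cong (suc n) f≡g = cong₂ _+_ (f≡g 0 (s≤s z≤n)) (sumTo-cong n (λ i i<n → f≡g (suc i) (s≤s i<n)))

  sumTo-zero : ∀ n {f} → (∀ i → i < n → f i ≡ 0#) → sumTo n f ≡ 0#
  sumTo-zero zero    f≡0 = refl
  sumTo-zero (suc n) f≡0 =
    trans (cong₂ _+_ (f≡0 0 (s≤s z≤n)) (sumTo-zero n (λ i i<n → f≡0 (suc i) (s≤s i<n)))) (+-identityˡ 0#)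

  sumTo-+ : ∀ n f g → sumTo n (λ i → f i + g i) ≡ sumTo n f + sumTo n g
  sumTo-+ zero    f g = sym (+-identityˡ 0#)
  sumTo-+ (suc n) f g = trans (cong (_+_ (f 0 + g 0)) (sumTo-+ n _ _)) (+-interchange _ _ _ _)

  sumTo-*ˡ : ∀ n x f → sumTo n (λ i → x * f i) ≡ x * sumTo n f
  sumTo-*ˡ zero    x f = sym (zeroʳ x)
  sumTo-*ˡ (suc n) x f = trans (cong (_+_ (x * f 0)) (sumTo-*ˡ n x _)) (sym (distribˡ x _ _))

  sumTo-last : ∀ n f → sumTo (suc n) f ≡ sumTo n f + f n
  sumTo-last zero    f = trans (+-identityʳ _) (sym (+-identityˡ _))
  sumTo-last (suc n) f = trans (cong (_+_ (f 0)) (sumTo-last n _)) (sym (+-assoc _ _ _))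

  foldr-map-applyUpTo : ∀ (f : ℕ → Carrier) g n → foldr _+_ 0# (map f (applyUpTo g n)) ≡ sumTo n (λ i → f (g i))
  foldr-map-applyUpTo f g zero    = refl
  foldr-map-applyUpTo f g (suc n) = cong (_+_ (f (g 0))) (foldr-map-applyUpTo f (λ i → g (suc i)) n)

  infixl 7 _⋆_

  _⋆_ : (ℕ → Carrier) → (ℕ → Carrier) → ℕ → Carrier
  (a ⋆ b) k = sumTo (suc k) (λ j → a j * b (k ∸ j))

  ⋆-cong : ∀ {a a′ b b′} → (∀ i → a i ≡ a′ i) → (∀ i → b i ≡ b′ i) → ∀ k → (a ⋆ b) k ≡ (a′ ⋆ b′) k
  ⋆-cong a≡a′ b≡b′ k = sumTo-cong (suc k) (λ j _ → cong₂ _*_ (a≡a′ j) (b≡b′ (k ∸ j)))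

  ⋆-zeroˡ : ∀ {a} b → (∀ i → a i ≡ 0#) → ∀ k → (a ⋆ b) k ≡ 0#
  ⋆-zeroˡ b a≡0 k = sumTo-zero (suc k) (λ j _ → trans (cong (_* b (k ∸ j)) (a≡0 j)) (zeroˡ _))

  ⋆-zeroʳ : ∀ a {b} → (∀ i → b i ≡ 0#) → ∀ k → (a ⋆ b) k ≡ 0#
  ⋆-zeroʳ a b≡0 k = sumTo-zero (suc k) (λ j _ → trans (cong (a j *_) (b≡0 (k ∸ j))) (zeroʳ _))

  ⋆-beyond : ∀ A B a b k → (∀ i → A ≤ i → a i ≡ 0#) → (∀ j → B ≤ j → b j ≡ 0#) →
             A ℕ.+ B ≤ suc k → (a ⋆ b) k ≡ 0#
  ⋆-beyond zero    B a b k a≡0 b≡0 _ = ⋆-zeroˡ b (λ i → a≡0 i z≤n) k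
  ⋆-beyond (suc A) B a b zero a≡0 b≡0 (s≤s A+B≤k) =
    trans (cong (λ z → a 0 * z + 0#) (b≡0 0 (ℕ.m+n≤o⇒n≤o A A+B≤k)))
          (trans (+-identityʳ _) (zeroʳ (a 0)))
  ⋆-beyond (suc A) B a b (suc k) a≡0 b≡0 (s≤s A+B≤k) =
    trans (cong₂ (λ z w → a 0 * z + w) (b≡0 (suc k) (ℕ.m+n≤o⇒n≤o A A+B≤k))
                 (⋆-beyond A B (λ i → a (suc i)) b k (λ i A≤i → a≡0 (suc i) (s≤s A≤i)) b≡0 A+B≤k))
          (trans (+-identityʳ _) (zeroʳ (a 0)))

  ⋆-sucʳ : ∀ a b k → (a ⋆ b) (suc k) ≡ (a ⋆ (λ i → b (suc i))) k + a (suc k) * b 0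
  ⋆-sucʳ a b k = begin
    sumTo (suc (suc k)) f      ≡⟨ sumTo-last (suc k) f ⟩
    sumTo (suc k) f + f (suc k) ≡⟨ cong₂ _+_
                                    (sumTo-cong (suc k) (λ j j≤k → cong (λ i → a j * b i) (ℕ.+-∸-assoc 1 (ℕ.≤-pred j≤k))))
                                    (cong (λ i → a (suc k) * b i) (ℕ.n∸n≡0 k)) ⟩
    (a ⋆ (λ i → b (suc i))) k + a (suc k) * b 0 ∎
    where
    f : ℕ → Carrier
    f = λ j → a j * b (suc k ∸ j)

  ⋆-comm : ∀ a b k → (a ⋆ b) k ≡ (b ⋆ a) k
  ⋆-comm a b zero    = cong (_+ 0#) (*-comm (a 0) (b 0))
  ⋆-comm a b (suc k) = begin
    a 0 * b (suc k) + (a′ ⋆ b) k  ≡⟨ cong₂ _+_ (*-comm (a 0) _) (⋆-comm a′ b k) ⟩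
    b (suc k) * a 0 + (b ⋆ a′) k  ≡⟨ +-comm _ _ ⟩
    (b ⋆ a′) k + b (suc k) * a 0  ≡⟨ ⋆-sucʳ b a k ⟨
    (b ⋆ a) (suc k)               ∎
    where
    a′ : ℕ → Carrier
    a′ = λ i → a (suc i)

  ⋆-distribʳ-+ : ∀ a a′ b k → ((λ i → a i + a′ i) ⋆ b) k ≡ (a ⋆ b) k + (a′ ⋆ b) k
  ⋆-distribʳ-+ a a′ b k =
    trans (sumTo-cong (suc k) (λ j _ → distribʳ (b (k ∸ j)) (a j) (a′ j)))
          (sumTo-+ (suc k) (λ j → a j * b (k ∸ j)) (λ j → a′ j * b (k ∸ j)))

  ⋆-*ˡ : ∀ x a b k → ((λ i → x * a i) ⋆ b) k ≡ x * (a ⋆ b) k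
  ⋆-*ˡ x a b k =
    trans (sumTo-cong (suc k) (λ j _ → *-assoc x (a j) (b (k ∸ j)))) (sumTo-*ˡ (suc k) x (λ j → a j * b (k ∸ j)))

  ⋆-assoc : ∀ a b d k → ((a ⋆ b) ⋆ d) k ≡ (a ⋆ (b ⋆ d)) k
  ⋆-assoc a b d zero = begin
    (a 0 * b 0 + 0#) * d 0 + 0#   ≡⟨ cong (λ z → z * d 0 + 0#) (+-identityʳ _) ⟩
    (a 0 * b 0) * d 0 + 0#        ≡⟨ cong (_+ 0#) (*-assoc _ _ _) ⟩
    a 0 * (b 0 * d 0) + 0#        ≡⟨ cong (λ z → a 0 * z + 0#) (+-identityʳ _) ⟨
    a 0 * (b 0 * d 0 + 0#) + 0#   ∎
  ⋆-assoc a b d (suc k) = begin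
    (a ⋆ b) 0 * d (suc k) + ((λ i → (a ⋆ b) (suc i)) ⋆ d) k
      ≡⟨ cong₂ _+_ (cong (_* d (suc k)) (+-identityʳ _)) (⋆-distribʳ-+ (λ i → a 0 * b (suc i)) (a′ ⋆ b) d k) ⟩
    (a 0 * b 0) * d (suc k) + (((λ i → a 0 * b (suc i)) ⋆ d) k + ((a′ ⋆ b) ⋆ d) k)
      ≡⟨ cong₂ (λ u w → (a 0 * b 0) * d (suc k) + (u + w)) (⋆-*ˡ (a 0) b′ d k) (⋆-assoc a′ b d k) ⟩
    (a 0 * b 0) * d (suc k) + (a 0 * (b′ ⋆ d) k + (a′ ⋆ (b ⋆ d)) k)
      ≡⟨ +-assoc _ _ _ ⟨
    ((a 0 * b 0) * d (suc k) + a 0 * (b′ ⋆ d) k) + (a′ ⋆ (b ⋆ d)) k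
      ≡⟨ cong (_+ (a′ ⋆ (b ⋆ d)) k) (trans (cong (_+ a 0 * (b′ ⋆ d) k) (*-assoc _ _ _)) (sym (distribˡ (a 0) _ _))) ⟩
    a 0 * (b ⋆ d) (suc k) + (a′ ⋆ (b ⋆ d)) k
      ∎
    where
    a′ : ℕ → Carrier
    a′ = λ i → a (suc i)
    b′ : ℕ → Carrier
    b′ = λ i → b (suc i)

  coeff-beyond : ∀ a i → length a ≤ i → c a i ≡ 0#
  coeff-beyond []      i       _         = refl
  coeff-beyond (x ∷ a) (suc i) (s≤s a≤i) = coeff-beyond a i a≤i

  coeff-map-applyUpTo : ∀ (f : ℕ → Carrier) g N k → k < N → c (map f (applyUpTo g N)) k ≡ f (g k)
  coeff-map-applyUpTo f g (suc N) zero    _         = refl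
  coeff-map-applyUpTo f g (suc N) (suc k) (s≤s k<N) = coeff-map-applyUpTo f (λ i → g (suc i)) N k k<N

  coeff-*ₚ : ∀ a b k → c (a *ₚ b) k ≡ (c a ⋆ c b) k
  coeff-*ₚ a b k with k ℕ.<? length a ℕ.+ length b ∸ 1
  ... | yes k<N = trans (coeff-map-applyUpTo (conv K q a b) (λ i → i) _ k k<N)
                        (foldr-map-applyUpTo _ (λ i → i) (suc k))
  ... | no  k≮N = trans (coeff-beyond (a *ₚ b) k (ℕ.≤-trans (ℕ.≤-reflexive length-product) (ℕ.≮⇒≥ k≮N)))
                        (sym (⋆-beyond (length a) (length b) (c a) (c b) k (coeff-beyond a) (coeff-beyond b)
                               (ℕ.≤-trans (ℕ.m≤n+m∸n (length a ℕ.+ length b) 1) (s≤s (ℕ.≮⇒≥ k≮N)))))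
    where
    N : ℕ
    N = length a ℕ.+ length b ∸ 1
    length-product : length (a *ₚ b) ≡ N
    length-product = trans (length-map (conv K q a b) (upTo N)) (length-applyUpTo (λ i → i) N)

  *ₚ-cong : ∀ {a a′ b b′} → a ≈ₚ a′ → b ≈ₚ b′ → a *ₚ b ≈ₚ a′ *ₚ b′
  *ₚ-cong {a} {a′} {b} {b′} a≈a′ b≈b′ k =
    trans (coeff-*ₚ a b k) (trans (⋆-cong a≈a′ b≈b′ k) (sym (coeff-*ₚ a′ b′ k)))

  *ₚ-comm : ∀ a b → a *ₚ b ≈ₚ b *ₚ a
  *ₚ-comm a b k = trans (coeff-*ₚ a b k) (trans (⋆-comm (c a) (c b) k) (sym (coeff-*ₚ b a k)))

  *ₚ-assoc : ∀ a b d → a *ₚ b *ₚ d ≈ₚ a *ₚ (b *ₚ d)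
  *ₚ-assoc a b d k = begin
    c (a *ₚ b *ₚ d) k          ≡⟨ coeff-*ₚ (a *ₚ b) d k ⟩
    (c (a *ₚ b) ⋆ c d) k       ≡⟨ ⋆-cong {b = c d} (coeff-*ₚ a b) (λ _ → refl) k ⟩
    ((c a ⋆ c b) ⋆ c d) k      ≡⟨ ⋆-assoc (c a) (c b) (c d) k ⟩
    (c a ⋆ (c b ⋆ c d)) k      ≡⟨ ⋆-cong {a = c a} (λ _ → refl) (coeff-*ₚ b d) k ⟨
    (c a ⋆ c (b *ₚ d)) k       ≡⟨ coeff-*ₚ a (b *ₚ d) k ⟨
    c (a *ₚ (b *ₚ d)) k        ∎

  *ₚ-identityʳ : ∀ a → a *ₚ 1ₚ ≈ₚ a
  *ₚ-identityʳ a k = trans (coeff-*ₚ a 1ₚ k) (trans (⋆-comm (c a) (c 1ₚ) k) (1⋆a k))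
    where
    1⋆a : ∀ k → (c 1ₚ ⋆ c a) k ≡ c a k
    1⋆a zero    = trans (+-identityʳ _) (*-identityˡ _)
    1⋆a (suc k) = trans (cong₂ _+_ (*-identityˡ _) (⋆-zeroˡ (c a) (λ _ → refl) k)) (+-identityʳ _)

  InFq-0# : InFq K q 0#
  InFq-0# = 0^n≡0 q 1≤q

  InFq-1# : InFq K q 1#
  InFq-1# = 1^n≡1 q

  InFq-+ : ∀ {x y} → InFq K q x → InFq K q y → InFq K q (x + y)
  InFq-+ {x} {y} x^q≡x y^q≡y = trans (frobenius x y) (cong₂ _+_ x^q≡x y^q≡y)

  InFq-* : ∀ {x y} → InFq K q x → InFq K q y → InFq K q (x * y)
  InFq-* {x} {y} x^q≡x y^q≡y = trans (^-distrib-* x y q) (cong₂ _*_ x^q≡x y^q≡y)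

  InFq-sumTo : ∀ n f → (∀ i → InFq K q (f i)) → InFq K q (sumTo n f)
  InFq-sumTo zero    f _    = InFq-0#
  InFq-sumTo (suc n) f f∈Fq = InFq-+ (f∈Fq 0) (InFq-sumTo n (λ i → f (suc i)) (λ i → f∈Fq (suc i)))

  InFq-coeff : ∀ a → PolyOverFq K q a → ∀ i → InFq K q (c a i)
  InFq-coeff []      _              i       = InFq-0#
  InFq-coeff (x ∷ a) (x∈Fq , _)     zero    = x∈Fq
  InFq-coeff (x ∷ a) (_ , a∈Fq[x])  (suc i) = InFq-coeff a a∈Fq[x] i

  PolyOverFq-map-applyUpTo : ∀ (f : ℕ → Carrier) g N → (∀ k → InFq K q (f k)) →
                             PolyOverFq K q (map f (applyUpTo g N))
  PolyOverFq-map-applyUpTo f g zero    _    = tt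
  PolyOverFq-map-applyUpTo f g (suc N) f∈Fq = f∈Fq (g 0) , PolyOverFq-map-applyUpTo f (λ i → g (suc i)) N f∈Fq

  PolyOverFq-*ₚ : ∀ a b → PolyOverFq K q a → PolyOverFq K q b → PolyOverFq K q (a *ₚ b)
  PolyOverFq-*ₚ a b a∈Fq[x] b∈Fq[x] = PolyOverFq-map-applyUpTo (conv K q a b) (λ i → i) _ λ k →
    subst (InFq K q) (sym (foldr-map-applyUpTo _ (λ i → i) (suc k)))
      (InFq-sumTo (suc k) _ (λ j → InFq-* (InFq-coeff a a∈Fq[x] j) (InFq-coeff b b∈Fq[x] (k ∸ j))))

  ∣ₚ-refl : ∀ a → a ∣ₚ a
  ∣ₚ-refl a = 1ₚ , (InFq-1# , tt) , *ₚ-identityʳ a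

  ∣ₚ-trans : ∀ {a b d} → a ∣ₚ b → b ∣ₚ d → a ∣ₚ d
  ∣ₚ-trans {a} {b} {d} (s , s∈Fq[x] , as≈b) (t , t∈Fq[x] , bt≈d) =
    s *ₚ t , PolyOverFq-*ₚ s t s∈Fq[x] t∈Fq[x] ,
    λ i → trans (sym (*ₚ-assoc a s t i)) (trans (*ₚ-cong {a *ₚ s} {b} {t} {t} as≈b (λ _ → refl) i) (bt≈d i))

  ∣ₚ-*ʳ : ∀ a b → PolyOverFq K q b → a ∣ₚ a *ₚ b
  ∣ₚ-*ʳ a b b∈Fq[x] = b , b∈Fq[x] , λ _ → refl

  ∣ₚ-*ˡ : ∀ a b → PolyOverFq K q a → b ∣ₚ a *ₚ b
  ∣ₚ-*ˡ a b a∈Fq[x] = a , a∈Fq[x] , *ₚ-comm b a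

  infixl 6 _+ₚ_

  _+ₚ_ : Polynomial → Polynomial → Polynomial
  []      +ₚ b       = b
  (x ∷ a) +ₚ []      = x ∷ a
  (x ∷ a) +ₚ (y ∷ b) = (x + y) ∷ (a +ₚ b)

  coeff-+ₚ : ∀ a b k → c (a +ₚ b) k ≡ c a k + c b k
  coeff-+ₚ []      b       k       = sym (+-identityˡ _)
  coeff-+ₚ (x ∷ a) []      k       = sym (+-identityʳ _)
  coeff-+ₚ (x ∷ a) (y ∷ b) zero    = refl
  coeff-+ₚ (x ∷ a) (y ∷ b) (suc k) = coeff-+ₚ a b k

  scale : Carrier → Polynomial → Polynomial
  scale x = map (x *_)

  coeff-scale : ∀ x a k → c (scale x a) k ≡ x * c a k
  coeff-scale x []      k       = sym (zeroʳ x)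
  coeff-scale x (y ∷ a) zero    = refl
  coeff-scale x (y ∷ a) (suc k) = coeff-scale x a k

  *ₚ-consˡ : ∀ x a b → (x ∷ a) *ₚ b ≈ₚ scale x b +ₚ (0# ∷ a *ₚ b)
  *ₚ-consˡ x a b zero = begin
    c ((x ∷ a) *ₚ b) 0               ≡⟨ coeff-*ₚ (x ∷ a) b 0 ⟩
    x * c b 0 + 0#                   ≡⟨ cong (_+ 0#) (coeff-scale x b 0) ⟨
    c (scale x b) 0 + 0#             ≡⟨ coeff-+ₚ (scale x b) (0# ∷ a *ₚ b) 0 ⟨
    c (scale x b +ₚ (0# ∷ a *ₚ b)) 0 ∎
  *ₚ-consˡ x a b (suc k) = begin
    c ((x ∷ a) *ₚ b) (suc k)               ≡⟨ coeff-*ₚ (x ∷ a) b (suc k) ⟩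
    x * c b (suc k) + (c a ⋆ c b) k        ≡⟨ cong₂ _+_ (coeff-scale x b (suc k)) (coeff-*ₚ a b k) ⟨
    c (scale x b) (suc k) + c (a *ₚ b) k   ≡⟨ coeff-+ₚ (scale x b) (0# ∷ a *ₚ b) (suc k) ⟨
    c (scale x b +ₚ (0# ∷ a *ₚ b)) (suc k) ∎

  linFrom-suc : ∀ i a γ → linFrom K q (suc i) a γ ≡ linFrom K q i a (γ ^ q)
  linFrom-suc i []      γ = refl
  linFrom-suc i (x ∷ a) γ = cong₂ (λ u w → x * u + w) (sym (^-assocʳ γ q (q ℕ.^ i))) (linFrom-suc (suc i) a γ)

  linFrom-^q : ∀ i a γ → PolyOverFq K q a → linFrom K q i a (γ ^ q) ≡ linFrom K q i a γ ^ q
  linFrom-^q i []      γ _                  = sym InFq-0#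
  linFrom-^q i (x ∷ a) γ (x∈Fq , a∈Fq[x]) = begin
    x * (γ ^ q) ^ (q ℕ.^ i) + linFrom K q (suc i) a (γ ^ q)
      ≡⟨ cong₂ _+_ (cong₂ _*_ (sym x∈Fq) (^-comm γ q (q ℕ.^ i))) (linFrom-^q (suc i) a γ a∈Fq[x]) ⟩
    x ^ q * (γ ^ (q ℕ.^ i)) ^ q + linFrom K q (suc i) a γ ^ q
      ≡⟨ cong (_+ linFrom K q (suc i) a γ ^ q) (^-distrib-* x _ q) ⟨
    (x * γ ^ (q ℕ.^ i)) ^ q + linFrom K q (suc i) a γ ^ q
      ≡⟨ frobenius _ _ ⟨
    (x * γ ^ (q ℕ.^ i) + linFrom K q (suc i) a γ) ^ q
      ∎

  linFrom-zero : ∀ i a γ → (∀ k → c a k ≡ 0#) → linFrom K q i a γ ≡ 0#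
  linFrom-zero i []      γ _   = refl
  linFrom-zero i (x ∷ a) γ a≡0 =
    trans (cong₂ (λ u w → u * γ ^ (q ℕ.^ i) + w) (a≡0 0) (linFrom-zero (suc i) a γ (λ k → a≡0 (suc k))))
          (trans (+-identityʳ _) (zeroˡ _))

  linFrom-cong : ∀ i a b γ → a ≈ₚ b → linFrom K q i a γ ≡ linFrom K q i b γ
  linFrom-cong i []      b       γ a≈b = sym (linFrom-zero i b γ (λ k → sym (a≈b k)))
  linFrom-cong i (x ∷ a) []      γ a≈b = linFrom-zero i (x ∷ a) γ a≈b
  linFrom-cong i (x ∷ a) (y ∷ b) γ a≈b =
    cong₂ (λ u w → u * γ ^ (q ℕ.^ i) + w) (a≈b 0) (linFrom-cong (suc i) a b γ (λ k → a≈b (suc k)))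

  linFrom-+ₚ : ∀ i a b γ → linFrom K q i (a +ₚ b) γ ≡ linFrom K q i a γ + linFrom K q i b γ
  linFrom-+ₚ i []      b       γ = sym (+-identityˡ _)
  linFrom-+ₚ i (x ∷ a) []      γ = sym (+-identityʳ _)
  linFrom-+ₚ i (x ∷ a) (y ∷ b) γ =
    trans (cong₂ _+_ (distribʳ (γ ^ (q ℕ.^ i)) x y) (linFrom-+ₚ (suc i) a b γ)) (+-interchange _ _ _ _)

  linFrom-scale : ∀ i x a γ → linFrom K q i (scale x a) γ ≡ x * linFrom K q i a γ
  linFrom-scale i x []      γ = sym (zeroʳ x)
  linFrom-scale i x (y ∷ a) γ =
    trans (cong₂ _+_ (*-assoc x y _) (linFrom-scale (suc i) x a γ)) (sym (distribˡ x _ _))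

  ∘L-*ₚ : ∀ a b δ → PolyOverFq K q b → _∘L_ K q (a *ₚ b) δ ≡ _∘L_ K q a (_∘L_ K q b δ)
  ∘L-*ₚ [] b δ _ = linFrom-zero 0 ([] *ₚ b) δ (λ k → trans (coeff-*ₚ [] b k) (⋆-zeroˡ (c b) (λ _ → refl) k))
  ∘L-*ₚ (x ∷ a) b δ b∈Fq[x] = begin
    L0 ((x ∷ a) *ₚ b) δ
      ≡⟨ linFrom-cong 0 ((x ∷ a) *ₚ b) (scale x b +ₚ (0# ∷ a *ₚ b)) δ (*ₚ-consˡ x a b) ⟩
    L0 (scale x b +ₚ (0# ∷ a *ₚ b)) δ
      ≡⟨ linFrom-+ₚ 0 (scale x b) (0# ∷ a *ₚ b) δ ⟩
    L0 (scale x b) δ + (0# * δ ^ 1 + L1 (a *ₚ b) δ)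
      ≡⟨ cong₂ _+_ (linFrom-scale 0 x b δ) (trans (cong (_+ L1 (a *ₚ b) δ) (zeroˡ _)) (+-identityˡ _)) ⟩
    x * y + L1 (a *ₚ b) δ
      ≡⟨ cong (_+_ (x * y)) (linFrom-suc 0 (a *ₚ b) δ) ⟩
    x * y + L0 (a *ₚ b) (δ ^ q)
      ≡⟨ cong (_+_ (x * y)) (∘L-*ₚ a b (δ ^ q) b∈Fq[x]) ⟩
    x * y + L0 a (L0 b (δ ^ q))
      ≡⟨ cong (λ w → x * y + L0 a w) (linFrom-^q 0 b δ b∈Fq[x]) ⟩
    x * y + L0 a (y ^ q)
      ≡⟨ cong₂ (λ u w → x * u + w) (sym (*-identityʳ y)) (sym (linFrom-suc 0 a y)) ⟩
    x * y ^ 1 + L1 a y ∎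
    where
    L0 : Polynomial → Carrier → Carrier
    L0 = linFrom K q 0
    L1 : Polynomial → Carrier → Carrier
    L1 = linFrom K q 1
    y : Carrier
    y = L0 b δ

  degree : Polynomial → ℕ
  degree a = length a ∸ 1

  coeff-aboveDegree : ∀ a i → degree a < i → c a i ≡ 0#
  coeff-aboveDegree []      i _         = refl
  coeff-aboveDegree (x ∷ a) i deg<i = coeff-beyond (x ∷ a) i deg<i

  monic-leading : ∀ a → MonicFq K q a → c a (degree a) ≡ 1#
  monic-leading a (_ , last≡1) = go a last≡1
    where
    go : ∀ a → lastIs1 K q a → c a (degree a) ≡ 1#
    go []          0≡1 = 0≡1
    go (x ∷ [])    x≡1 = x≡1
    go (x ∷ y ∷ a) l   = go (y ∷ a) l

  monic-≉1⇒2≤length : ∀ a → MonicFq K q a → ¬ a ≈ₚ 1ₚ → 2 ≤ length a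
  monic-≉1⇒2≤length []          (_ , 0≡1) _    = ⊥-elim (0≢1 0≡1)
  monic-≉1⇒2≤length (x ∷ [])    (_ , x≡1) a≉1 = ⊥-elim (a≉1 λ { zero → x≡1 ; (suc i) → refl })
  monic-≉1⇒2≤length (x ∷ y ∷ a) _         _   = s≤s (s≤s z≤n)

  monic-2≤length⇒≉1 : ∀ a → MonicFq K q a → 2 ≤ length a → ¬ a ≈ₚ 1ₚ
  monic-2≤length⇒≉1 (x ∷ []) _ (s≤s ())
  monic-2≤length⇒≉1 (x ∷ y ∷ a) monic _ a≈1 =
    1≢0 (trans (sym (monic-leading (x ∷ y ∷ a) monic)) (a≈1 (suc (length a))))

  _≈ₚ?_ : ∀ a b → Dec (a ≈ₚ b)
  a ≈ₚ? b = go a b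
    where
    cons? : ∀ {u v : ℕ → Carrier} → Dec (u 0 ≡ v 0) → Dec (∀ i → u (suc i) ≡ v (suc i)) → Dec (∀ i → u i ≡ v i)
    cons? (yes head≡) (yes tail≡) = yes λ { zero → head≡ ; (suc i) → tail≡ i }
    cons? (no  head≢) _           = no λ u≡v → head≢ (u≡v 0)
    cons? _           (no tail≢)  = no λ u≡v → tail≢ (λ i → u≡v (suc i))
    go : ∀ a b → Dec (a ≈ₚ b)
    go []      []      = yes λ _ → refl
    go []      (y ∷ b) = cons? (0# ≟ y) (go [] b)
    go (x ∷ a) []      = cons? (x ≟ 0#) (go a [])
    go (x ∷ a) (y ∷ b) = cons? (x ≟ y) (go a b)

  zero⊎topCoeff : ∀ a → (∀ i → c a i ≡ 0#) ⊎ Σ ℕ (λ T → c a T ≢ 0# × (∀ j → T < j → c a j ≡ 0#))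
  zero⊎topCoeff []      = inj₁ λ _ → refl
  zero⊎topCoeff (x ∷ a) with zero⊎topCoeff a
  ... | inj₂ (T , top≢0 , above≡0) = inj₂ (suc T , top≢0 , λ { zero () ; (suc j) (s≤s T<j) → above≡0 j T<j })
  ... | inj₁ a≡0 with x ≟ 0#
  ...   | yes x≡0 = inj₁ λ { zero → x≡0 ; (suc i) → a≡0 i }
  ...   | no  x≢0 = inj₂ (0 , x≢0 , λ { zero () ; (suc j) _ → a≡0 j })

  ⋆-top : ∀ D T a b → (∀ i → D < i → a i ≡ 0#) → (∀ j → T < j → b j ≡ 0#) → (a ⋆ b) (D ℕ.+ T) ≡ a D * b T
  ⋆-top zero zero a b _ _ = +-identityʳ _
  ⋆-top zero (suc T) a b a≡0 _ =
    trans (cong (_+_ (a 0 * b (suc T))) (⋆-zeroˡ b (λ i → a≡0 (suc i) (s≤s z≤n)) T)) (+-identityʳ _)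
  ⋆-top (suc D) T a b a≡0 b≡0 = begin
    a 0 * b (suc (D ℕ.+ T)) + ((λ i → a (suc i)) ⋆ b) (D ℕ.+ T)
      ≡⟨ cong₂ (λ u w → a 0 * u + w) (b≡0 _ (s≤s (ℕ.m≤n+m T D)))
               (⋆-top D T (λ i → a (suc i)) b (λ i D<i → a≡0 (suc i) (s≤s D<i)) b≡0) ⟩
    a 0 * 0# + a (suc D) * b T   ≡⟨ cong (_+ a (suc D) * b T) (zeroʳ _) ⟩
    0# + a (suc D) * b T         ≡⟨ +-identityˡ _ ⟩
    a (suc D) * b T              ∎

  ⋆-constʳ : ∀ a b k → (∀ j → 0 < j → b j ≡ 0#) → (a ⋆ b) k ≡ a k * b 0
  ⋆-constʳ a b k b≡0 = trans (⋆-comm a b k) (go k)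
    where
    go : ∀ k → (b ⋆ a) k ≡ a k * b 0
    go zero    = trans (+-identityʳ _) (*-comm _ _)
    go (suc k) = trans (cong₂ _+_ (*-comm _ _) (⋆-zeroˡ a (λ i → b≡0 (suc i) (s≤s z≤n)) k)) (+-identityʳ _)

  coeff-*ₚ-monic-top : ∀ d t T → MonicFq K q d → (∀ j → T < j → c t j ≡ 0#) → c (d *ₚ t) (degree d ℕ.+ T) ≡ c t T
  coeff-*ₚ-monic-top d t T d-monic t-above≡0 = begin
    c (d *ₚ t) (degree d ℕ.+ T)   ≡⟨ coeff-*ₚ d t _ ⟩
    (c d ⋆ c t) (degree d ℕ.+ T)  ≡⟨ ⋆-top (degree d) T (c d) (c t) (coeff-aboveDegree d) t-above≡0 ⟩
    c d (degree d) * c t T        ≡⟨ cong (_* c t T) (monic-leading d d-monic) ⟩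
    1# * c t T                    ≡⟨ *-identityˡ _ ⟩
    c t T                         ∎

  coeff-*ₚ-constʳ : ∀ d t k → (∀ j → 0 < j → c t j ≡ 0#) → c (d *ₚ t) k ≡ c d k * c t 0
  coeff-*ₚ-constʳ d t k t-above≡0 = trans (coeff-*ₚ d t k) (⋆-constʳ (c d) (c t) k t-above≡0)

  properMonicDivisor-length< : ∀ d t h → MonicFq K q d → MonicFq K q h → d *ₚ t ≈ₚ h → ¬ d ≈ₚ h →
                               length d < length h
  properMonicDivisor-length< d t h d-monic h-monic dt≈h d≉h with length d ℕ.<? length h
  ... | yes d<h = d<h
  ... | no  d≮h with zero⊎topCoeff t
  ...   | inj₁ t≡0 = ⊥-elim (1≢0 (begin
    1#                      ≡⟨ monic-leading h h-monic ⟨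
    c h (degree h)          ≡⟨ dt≈h (degree h) ⟨
    c (d *ₚ t) (degree h)   ≡⟨ coeff-*ₚ d t (degree h) ⟩
    (c d ⋆ c t) (degree h)  ≡⟨ ⋆-zeroʳ (c d) t≡0 (degree h) ⟩
    0#                      ∎))
  ...   | inj₂ (T , tT≢0 , t-above≡0) = ⊥-elim (d≉h λ k → begin
    c d k                   ≡⟨ *-identityʳ _ ⟨
    c d k * 1#              ≡⟨ cong (c d k *_) t0≡1 ⟨
    c d k * c t 0           ≡⟨ coeff-*ₚ-constʳ d t k t-constant ⟨
    c (d *ₚ t) k            ≡⟨ dt≈h k ⟩
    c h k                   ∎)
    where
    D : ℕ
    D = degree d
    H : ℕ
    H = degree h
    H≤D : H ≤ D
    H≤D = ℕ.∸-monoˡ-≤ 1 (ℕ.≮⇒≥ d≮h)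
    top : c h (D ℕ.+ T) ≡ c t T
    top = trans (sym (dt≈h (D ℕ.+ T))) (coeff-*ₚ-monic-top d t T d-monic t-above≡0)
    D+T≤H : D ℕ.+ T ≤ H
    D+T≤H with D ℕ.+ T ℕ.≤? H
    ... | yes D+T≤H = D+T≤H
    ... | no  D+T≰H = ⊥-elim (tT≢0 (trans (sym top) (coeff-aboveDegree h _ (ℕ.≰⇒> D+T≰H))))
    T≡0 : T ≡ 0
    T≡0 = ℕ.n≤0⇒n≡0 (ℕ.+-cancelˡ-≤ D T 0 (subst (D ℕ.+ T ≤_) (sym (ℕ.+-identityʳ D)) (ℕ.≤-trans D+T≤H H≤D)))
    t-constant : ∀ j → 0 < j → c t j ≡ 0#
    t-constant j 0<j = t-above≡0 j (subst (_< j) (sym T≡0) 0<j)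
    t0≡1 : c t 0 ≡ 1#
    t0≡1 = begin
      c t 0             ≡⟨ *-identityˡ _ ⟨
      1# * c t 0        ≡⟨ cong (_* c t 0) (monic-leading d d-monic) ⟨
      c d D * c t 0     ≡⟨ coeff-*ₚ-constʳ d t D t-constant ⟨
      c (d *ₚ t) D      ≡⟨ dt≈h D ⟩
      c h D             ≡⟨ cong (c h) (ℕ.≤-antisym (ℕ.≤-trans (ℕ.m≤m+n D T) D+T≤H) H≤D) ⟩
      c h H             ≡⟨ monic-leading h h-monic ⟩
      1#                ∎

  -- Irreducibility is not decidable, so the divisor exists only up to double
  -- negation; this suffices because it is only used to derive ⊥.
  irreducibleDivisor : ∀ h → MonicFq K q h → 2 ≤ length h →
                       ¬ ¬ Σ Polynomial (λ d → IrreducibleFq K q d × d ∣ₚ h)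
  irreducibleDivisor h = bounded (length h) h ℕ.≤-refl
    where
    bounded : ∀ n h → length h ≤ n → MonicFq K q h → 2 ≤ length h →
              ¬ ¬ Σ Polynomial (λ d → IrreducibleFq K q d × d ∣ₚ h)
    bounded zero    h h≤0 _       2≤h _          = ℕ.<⇒≱ 2≤h (ℕ.≤-trans h≤0 z≤n)
    bounded (suc n) h h≤n h-monic 2≤h noDivisor =
      noDivisor (h , (h-monic , 2≤h , onlyTrivialDivisors) , ∣ₚ-refl h)
      where
      onlyTrivialDivisors : ∀ d → MonicFq K q d → d ∣ₚ h → d ≈ₚ 1ₚ ⊎ d ≈ₚ h
      onlyTrivialDivisors d d-monic d∣h@(t , _ , dt≈h) with d ≈ₚ? 1ₚ | d ≈ₚ? h
      ... | yes d≈1 | _       = inj₁ d≈1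
      ... | no _    | yes d≈h = inj₂ d≈h
      ... | no d≉1  | no d≉h  = ⊥-elim (bounded n d d≤n d-monic (monic-≉1⇒2≤length d d-monic d≉1)
                                   λ (e , e-irreducible , e∣d) → noDivisor (e , e-irreducible , ∣ₚ-trans {e} {d} {h} e∣d d∣h))
        where
        d≤n : length d ≤ n
        d≤n = ℕ.≤-pred (ℕ.≤-trans (properMonicDivisor-length< d t h d-monic h-monic dt≈h d≉h) h≤n)

  GFree-∣ : ∀ {d G} γ → d ∣ₚ G → GFree K q G γ → GFree K q d γ
  GFree-∣ {d} {G} γ d∣G G-free h h-monic h∣d = G-free h h-monic (∣ₚ-trans {h} {d} {G} h∣d d∣G)

  GFree-fromIrreducibles : ∀ X g γ → PolyOverFq K q g → GFree K q g γ →
                           (∀ d → IrreducibleFq K q d → d ∣ₚ X → ¬ d ∣ₚ g → GFree K q (g *ₚ d) γ) →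
                           GFree K q X γ
  GFree-fromIrreducibles X g γ g∈Fq[x] g-free gd-free h h-monic h∣X h≉1 (δ , γ≡h∘δ) =
    irreducibleDivisor h h-monic (monic-≉1⇒2≤length h h-monic h≉1)
      λ (d , d-irreducible@(d-monic , 2≤d , _) , d∣h@(e , e∈Fq[x] , de≈h)) →
        -- d ∣ g need not be decided: g-freeness refutes it, which is what (g d)-freeness needs.
        let d≉1 = monic-2≤length⇒≉1 d d-monic 2≤d
            γ≡d∘eδ : γ ≡ _∘L_ K q d (_∘L_ K q e δ)
            γ≡d∘eδ = trans γ≡h∘δ
              (trans (linFrom-cong 0 h (d *ₚ e) δ (λ i → sym (de≈h i))) (∘L-*ₚ d e δ e∈Fq[x]))
            d∤g : ¬ d ∣ₚ g
            d∤g d∣g = g-free d d-monic d∣g d≉1 (_ , γ≡d∘eδ)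
        in gd-free d d-irreducible (∣ₚ-trans {d} {h} {X} d∣h h∣X) d∤g
                   d d-monic (∣ₚ-*ˡ g d g∈Fq[x]) d≉1 (_ , γ≡d∘eδ)

module Freeness (K : FiniteField) (q n : ℕ) where
  open FieldProperties K

  InC-^ : ∀ r {δ} s → InC K q n r δ → InC K q n r (δ ^ s)
  InC-^ r {δ} s (δ≢0 , δ^Q≡1) =
    x^n≢0 s δ≢0 , trans (^-comm δ s (quot (Qn-1 K q n) r)) (trans (cong (_^ s) δ^Q≡1) (1^n≡1 s))

  SrFree-∣ : ∀ {S T r α} → T ∣ S → SrFree K q n S r α → SrFree K q n T r α
  SrFree-∣ T∣S (α∈C , S-free) = α∈C , λ δ t δ∈C t∣T α≡δ^t → S-free δ t δ∈C (∣-trans t∣T T∣S) α≡δ^t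

  SrFree-fromPrimes : ∀ {R ℓ r α} → 0 < R → SrFree K q n ℓ r α →
                      (∀ p → Prime p → p ∣ R → ¬ p ∣ ℓ → SrFree K q n (ℓ ℕ.* p) r α) →
                      SrFree K q n R r α
  SrFree-fromPrimes {R} {ℓ} {r} {α} 0<R (α∈C , ℓ-free) ℓp-free = α∈C , R-free
    where
    R-free : ∀ δ t → InC K q n r δ → t ∣ R → α ≡ δ ^ t → t ≡ 1
    R-free δ t δ∈C t∣R α≡δ^t with t ℕ.≟ 1
    ... | yes t≡1 = t≡1
    ... | no  t≢1 with p , p-prime , divides s t≡s*p ← primeDivisor (divisor≢0 0<R t∣R) t≢1 =
      ⊥-elim (ℕ.nonTrivial⇒≢1 {{prime⇒nonTrivial p-prime}} (p-free (p ∣? ℓ)))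
      where
      α≡[δ^s]^p : α ≡ (δ ^ s) ^ p
      α≡[δ^s]^p = trans α≡δ^t (trans (cong (δ ^_) t≡s*p) (sym (^-assocʳ δ s p)))
      p-free : Dec (p ∣ ℓ) → p ≡ 1
      p-free (yes p∣ℓ) = ℓ-free (δ ^ s) p (InC-^ r s δ∈C) p∣ℓ α≡[δ^s]^p
      p-free (no  p∤ℓ) = proj₂ (ℓp-free p p-prime (∣-trans (divides s t≡s*p) t∣R) p∤ℓ)
                            (δ ^ s) p (InC-^ r s δ∈C) (n∣m*n ℓ) α≡[δ^s]^p

update-≡ : ∀ {m} (S : Fin m → ℕ) i x → update S i x i ≡ x
update-≡ S i x with i Fin.≟ i
... | yes _   = refl
... | no  i≢i = ⊥-elim (i≢i refl)

∣-update-* : ∀ {m} (S : Fin m → ℕ) i p j → S j ∣ update S i (S i ℕ.* p) j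
∣-update-* S i p j with j Fin.≟ i
... | yes refl = m∣m*n p
... | no  _    = ∣-refl

module CountedPairs (K : FiniteField) (q n m : ℕ) (β : FiniteField.Carrier K) (r : Fin m → ℕ)
                    (f : Poly K q) (v : Fin m) (1≤q : 1 ≤ q)
                    (frobenius : ∀ x y → FiniteField._^_ K (FiniteField._+_ K x y) q ≡
                                         FiniteField._+_ K (FiniteField._^_ K x q) (FiniteField._^_ K y q)) where
  open FieldProperties K hiding (frobenius)
  open Polynomials K q 1≤q frobenius
  open Freeness K q n

  Counted : (Fin m → ℕ) → Polynomial → Carrier × Carrier → Set
  Counted = NvPred K q n m β r f v

  Counted-update : ∀ ℓ i p G {a} → Counted (update ℓ i (ℓ i ℕ.* p)) G a → Counted ℓ G a
  Counted-update ℓ i p G (α≢0 , free , α≡f∘γ , γ-free) =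
    α≢0 , (λ j → SrFree-∣ {r = r j} (∣-update-* ℓ i p j) (free j)) , α≡f∘γ , γ-free

  Counted-*ₚ : ∀ S g h {a} → PolyOverFq K q h → Counted S (g *ₚ h) a → Counted S g a
  Counted-*ₚ S g h h∈Fq[x] (α≢0 , free , α≡f∘γ , γ-free) =
    α≢0 , free , α≡f∘γ , GFree-∣ {g} {g *ₚ h} _ (∣ₚ-*ʳ g h h∈Fq[x]) γ-free

  Counted-fromSieve : ∀ R ℓ X g {a} → (∀ i → 0 < R i) → PolyOverFq K q g → Counted ℓ g a →
                      (∀ i p → Prime p → p ∣ R i → ¬ p ∣ ℓ i → Counted (update ℓ i (ℓ i ℕ.* p)) g a) →
                      (∀ d → IrreducibleFq K q d → d ∣ₚ X → ¬ d ∣ₚ g → Counted ℓ (g *ₚ d) a) →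
                      Counted R X a
  Counted-fromSieve R ℓ X g {α , γ} 0<R g∈Fq[x] (α≢0 , ℓ-free , α≡f∘γ , γ-g-free) byPrime byIrreducible =
    α≢0 , R-free , α≡f∘γ ,
    GFree-fromIrreducibles X g γ g∈Fq[x] γ-g-free
      (λ d d-irr d∣X d∤g → proj₂ (proj₂ (proj₂ (byIrreducible d d-irr d∣X d∤g))))
    where
    R-free : ∀ i → SrFree K q n (R i) (r i) (α + natK (toℕ i) * β)
    R-free i = SrFree-fromPrimes {r = r i} (0<R i) (ℓ-free i) λ p p-prime p∣R p∤ℓ →
      subst (λ S → SrFree K q n S (r i) _) (update-≡ ℓ i _) (proj₁ (proj₂ (byPrime i p p-prime p∣R p∤ℓ)) i)

  primeSum : (ℓ : Fin m → ℕ) → Polynomial → (Fin m → List ℕ) → ((Fin m → ℕ) → Polynomial → ℕ) → ℕ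
  primeSum ℓ g ps Nv = sum (map (λ i → sum (map (λ p → Nv (update ℓ i (ℓ i ℕ.* p)) g) (ps i))) (allFin m))

  module Indices (ℓ : Fin m → ℕ) (g : Polynomial) (ps : Fin m → List ℕ) (hs : List Polynomial) where

    Index : Set
    Index = (Fin m × ℕ) ⊎ Polynomial

    parameters : Index → (Fin m → ℕ) × Polynomial
    parameters (inj₁ (i , p)) = update ℓ i (ℓ i ℕ.* p) , g
    parameters (inj₂ h)       = ℓ , g *ₚ h

    primeIndices : Fin m → List Index
    primeIndices i = map (inj₁ ∘ (i ,_)) (ps i)

    indices : List Index
    indices = concatMap primeIndices (allFin m) ++ map inj₂ hs

    sum-indices : ∀ Nv → sum (map (uncurry Nv ∘ parameters) indices) ≡
                         primeSum ℓ g ps Nv ℕ.+ sum (map (λ h → Nv ℓ (g *ₚ h)) hs)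
    sum-indices Nv = begin
      sum (map N indices)
        ≡⟨ cong sum (map-++ N (concatMap primeIndices (allFin m)) (map inj₂ hs)) ⟩
      sum (map N (concatMap primeIndices (allFin m)) ++ map N (map inj₂ hs))
        ≡⟨ sum-++ (map N (concatMap primeIndices (allFin m))) _ ⟩
      sum (map N (concatMap primeIndices (allFin m))) ℕ.+ sum (map N (map inj₂ hs))
        ≡⟨ cong₂ ℕ._+_ (trans (sum-map-concatMap N primeIndices (allFin m))
                               (cong sum (map-cong (λ i → cong sum (sym (map-∘ (ps i)))) (allFin m))))
                        (cong sum (sym (map-∘ hs))) ⟩
      primeSum ℓ g ps Nv ℕ.+ sum (map (λ h → Nv ℓ (g *ₚ h)) hs)
        ∎
      where
      open ≡-Reasoning
      N : Index → ℕ
      N = uncurry Nv ∘ parameters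

    length-indices : length indices ≡ sum (map (λ i → length (ps i)) (allFin m)) ℕ.+ length hs
    length-indices = trans (length-++ (concatMap primeIndices (allFin m)))
      (cong₂ ℕ._+_ (trans (length-concatMap primeIndices (allFin m))
                          (cong sum (map-cong (λ i → length-map _ (ps i)) (allFin m))))
                   (length-map inj₂ hs))

    inj₁∈indices : ∀ {i p} → p ∈ ps i → inj₁ (i , p) ∈ indices
    inj₁∈indices {i} p∈ps = ∈-++⁺ˡ (∈-concatMap⁺ primeIndices
      (Any.map (λ { refl → ∈-map⁺ (inj₁ ∘ (i ,_)) p∈ps }) (∈-allFin i)))

    inj₂∈indices : ∀ {h} → h ∈ hs → inj₂ h ∈ indices
    inj₂∈indices h∈hs = ∈-++⁺ʳ _ (∈-map⁺ inj₂ h∈hs)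

    inj₂∈indices⁻ : ∀ {h} → inj₂ h ∈ indices → h ∈ hs
    inj₂∈indices⁻ h∈ with ∈-++⁻ (concatMap primeIndices (allFin m)) h∈
    ... | inj₂ h∈map with _ , h∈hs , refl ← ∈-map⁻ inj₂ h∈map = h∈hs
    ... | inj₁ h∈primes with _ , h∈primeIndices ← Any.satisfied (∈-concatMap⁻ primeIndices {allFin m} h∈primes)
                        with _ , _ , () ← ∈-map⁻ _ h∈primeIndices

  Nv-sieve : ∀ R ℓ X g (ps : Fin m → List ℕ) (hs : List Polynomial) (Nv : (Fin m → ℕ) → Polynomial → ℕ) →
             (∀ S G → IsCountOf (Counted S G) (Nv S G)) →
             (∀ i → 0 < R i) → PolyOverFq K q g →
             (∀ i p → Prime p → p ∣ R i → ¬ p ∣ ℓ i → p ∈ ps i) →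
             (∀ h → h ∈ hs → PolyOverFq K q h) →
             (∀ d → IrreducibleFq K q d → d ∣ₚ X → ¬ d ∣ₚ g → d ∈ hs) →
             + Nv R X ℤ.≥ (+ primeSum ℓ g ps Nv ℤ.+ + sum (map (λ h → Nv ℓ (g *ₚ h)) hs))
                           ℤ.- ((+ (sum (map (λ i → length (ps i)) (allFin m)) ℕ.+ length hs) ℤ.- + 1) ℤ.* + Nv ℓ g)
  Nv-sieve R ℓ X g ps hs Nv Nv-count 0<R g∈Fq[x] primes-listed hs-overFq irreducibles-listed =
    ℕ-bound⇒ℤ-bound {primeSum ℓ g ps Nv} {sum (map (λ h → Nv ℓ (g *ₚ h)) hs)}
                    {s = sum (map (λ i → length (ps i)) (allFin m)) ℕ.+ length hs}
      (subst₂ _≤_ (cong (ℕ._+ Nv ℓ g) (sum-indices Nv)) (cong (λ t → Nv R X ℕ.+ t ℕ.* Nv ℓ g) length-indices)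
        (Sieve.count-sieve (≡-dec _≟_ _≟_) indices (uncurry Counted ∘ parameters) (uncurry Nv ∘ parameters)
          (Nv-count ℓ g) (Nv-count R X) (λ j → Nv-count _ _) coarser covered))
    where
    open Indices ℓ g ps hs
    coarser : ∀ j → j ∈ indices → ∀ {a} → uncurry Counted (parameters j) a → Counted ℓ g a
    coarser (inj₁ (i , p)) _   = Counted-update ℓ i p g
    coarser (inj₂ h) h∈indices = Counted-*ₚ ℓ g h (hs-overFq h (inj₂∈indices⁻ h∈indices))
    covered : ∀ {a} → Counted ℓ g a → (∀ j → j ∈ indices → uncurry Counted (parameters j) a) → Counted R X a
    covered counted inAll = Counted-fromSieve R ℓ X g 0<R g∈Fq[x] counted
      (λ i p p-prime p∣R p∤ℓ → inAll (inj₁ (i , p)) (inj₁∈indices (primes-listed i p p-prime p∣R p∤ℓ)))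
      (λ d d-irreducible d∣X d∤g → inAll (inj₂ d) (inj₂∈indices (irreducibles-listed d d-irreducible d∣X d∤g)))

lemma3p4 : (K : FiniteField) (q n m c k : ℕ) (β : FiniteField.Carrier K)
  → IsPrimePower q → 2 ≤ n → FiniteField.size K ≡ q ℕ.^ n
  → IsCharacteristic K c → 1 ≤ m → m ≤ c
  → β ≢ FiniteField.0# K
  → (r R ℓ : Fin m → ℕ)
  → (∀ i → 0 < r i × r i ∣ Qn-1 K q n)
  → (∀ i → 0 < R i × R i ∣ quot (Qn-1 K q n) (r i))
  → (f g : Poly K q)
  → MonicFq K q f → _∣P_ K q f (xⁿ-1 K q n) → length f ≡ suc k
  → MonicFq K q g → _∣P_ K q g (xⁿ-1 K q n)
  → (∀ i → 0 < ℓ i × ℓ i ∣ R i)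
  → (ps : Fin m → List ℕ)
  → (∀ i → Unique (ps i))
  → (∀ i p → (p ∈ ps i) ⇔ (Prime p × p ∣ R i × ¬ (p ∣ ℓ i)))
  → (hs : List (Poly K q))
  → Unique hs
  → (∀ h → (h ∈ hs) ⇔ (IrreducibleFq K q h × _∣P_ K q h (xⁿ-1 K q n) × ¬ (_∣P_ K q h g)))
  → (v : Fin m)
  → (Nv : (Fin m → ℕ) → Poly K q → ℕ)
  → (∀ S G → IsCountOf (NvPred K q n m β r f v S G) (Nv S G))
  → (+ Nv R (xⁿ-1 K q n))
      ℤ.≥ ((+ sum (map (λ i → sum (map (λ p → Nv (update ℓ i (ℓ i ℕ.* p)) g) (ps i))) (allFin m))
           ℤ.+ + sum (map (λ h → Nv ℓ (_*P_ K q g h)) hs))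
           ℤ.- ((+ (sum (map (λ i → length (ps i)) (allFin m)) ℕ.+ length hs) ℤ.- + 1)
                ℤ.* + Nv ℓ g))
lemma3p4 K q n m c k β q-primePower _ size≡q^n _ _ _ _ r R ℓ _ R-bounds f g _ _ _ g-monic _ _
         ps _ ps-spec hs _ hs-spec v Nv Nv-count =
  Nv-sieve R ℓ (xⁿ-1 K q n) g ps hs Nv Nv-count (proj₁ ∘ R-bounds) (proj₁ g-monic)
    (λ i p p-prime p∣R p∤ℓ → from (ps-spec i p) (p-prime , p∣R , p∤ℓ))
    (λ h h∈hs → proj₁ (proj₁ (proj₁ (to (hs-spec h) h∈hs))))
    (λ d d-irreducible d∣X d∤g → from (hs-spec d) (d-irreducible , d∣X , d∤g))
  where
  open Equivalence
  open FieldProperties K using (frobenius)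
  open CountedPairs K q n m β r f v (IsPrimePower⇒1≤ q-primePower) (frobenius {n = n} q-primePower size≡q^n)
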